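{- Let $p$ be an odd prime, $\gamma\vdash n-2p$ a self-conjugate $p$-core, and $\mathfrak{B}_\gamma$ the set of partitions of $n$ with $p$-core $\gamma$. Let $1\le i\le j<p$ with $i<p-1$. Then $\lceil i-1,j\rfloor\trianglelefteq\lceil i,j\rfloor$, and $\lceil i-1,j\rfloor\trianglelefteq\lceil i-1,j+1\rfloor$ whenever $j+1\le p-1$.
   Context: $\trianglelefteq$ is the dominance order on partitions ($\lambda\trianglelefteq\mu$ iff $\sum_{r\le k}\lambda_r\le\sum_{r\le k}\mu_r$ for all $k$). Abacus: for a partition $\lambda$, place beads at positions $\lambda_i-i$ ($i\ge1$) on the $p$-abacus (runners indexed by residues mod $p$; moving a bead down one position means $x\mapsto x+p$). For the $p$-core $\gamma$, let $\rho_0<\dots<\rho_{p-1}$ be the positions of the lowest bead on each runner; the runner containing $\rho_r$ is runner $r$. Labels: for $0\le a<b\le p-1$, $\langle a,b\rangle$ is obtained from the abacus of $\gamma$ by moving the beads at $\rho_a$ and $\rho_b$ each down one position; $\langle a\rangle$ by moving the bead at $\rho_a$ to $\rho_a+2p$; $\langle a^2\rangle$ by moving the bead at $\rho_a$ to $\rho_a+p$ and the bead at $\rho_a-p$ to $\rho_a$. Pyramid: for $0\le a\le b\le p-1$, ${}^a\gamma_b=1$ if $\rho_b-\rho_a<p$ and $0$ if $\rho_b-\rho_a>p$; extended by ${}^a\gamma_b=1$ if $a>b$ and ${}^a\gamma_b=0$ if $a<0$ or $b\ge p$. For $0\le a\le b<p$, $a<p-1$: $\lceil a,b\rfloor=\langle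 a+1\rangle$ if $a=b$ and ${}^{a+1}\gamma_{a+2}=0$; $\langle a+1,a+2\rangle$ if $a=b$ and ${}^{a+1}\gamma_{a+2}=1$; $\langle a+1,b\rangle$ if $a\ne b$ and ${}^{a+1}\gamma_b=0$; $\langle b^2\rangle$ if $a\ne b$, ${}^{a+1}\gamma_b=1$, ${}^a\gamma_b=0$; $\langle a\rangle$ if $a\ne b$, ${}^a\gamma_b=1$, ${}^a\gamma_{b+1}=0$; $\langle a,b+1\rangle$ if $a\ne b$ and ${}^a\gamma_{b+1}=1$. These are exactly the $p$-regular partitions of $\mathfrak{B}_\gamma$. -}

module Defs where

open import Data.Bool using (Bool; true; false; if_then_else_; not)
open import Data.Nat as ℕ using (ℕ; zero; suc; _+_; _*_; _∸_; _≤_; _<_; _≡ᵇ_; _<ᵇ_; _≤ᵇ_)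
open import Data.Nat.Divisibility using (_∣_)
open import Data.Integer as ℤ using (ℤ; +_)
open import Data.List using (List; []; _∷_; length; filter; map; upTo; take)
open import Data.Nat.ListAction using (sum)
open import Data.List.Relation.Unary.All using (All)
open import Data.List.Relation.Unary.Linked using (Linked)
open import Data.Product using (Σ; ∃; _×_; _,_)
open import Relation.Nullary using (¬_)
open import Relation.Nullary.Decidable using (⌊_⌋)
open import Relation.Binary.PropositionalEquality using (_≡_; _≢_)

IsPartition : List ℕ → Set
IsPartition λ′ = Linked ℕ._≥_ λ′ × All (λ x → 0 < x) λ′

size : List ℕ → ℕ
size = sum

-- part λ k = λ_{k+1}  (0-indexed; 0 beyond the length)
part : List ℕ → ℕ → ℕ
part []       _       = 0
part (x ∷ _)  zero    = x
part (_ ∷ xs) (suc k) = part xs k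

-- number of parts strictly bigger than c, i.e. λ'_{c+1}
colLen : List ℕ → ℕ → ℕ
colLen λ′ c = length (filter (λ x → c ℕ.<? x) λ′)

conj : List ℕ → List ℕ
conj λ′ = map (colLen λ′) (upTo (part λ′ 0))

SelfConjugate : List ℕ → Set
SelfConjugate λ′ = conj λ′ ≡ λ′

-- hook length of the cell in row r+1, column c+1 (when c < λ_{r+1})
hook : List ℕ → ℕ → ℕ → ℕ
hook λ′ r c = (part λ′ r ∸ c ∸ 1) + (colLen λ′ c ∸ r ∸ 1) + 1

IsCore : ℕ → List ℕ → Set
IsCore p λ′ = ∀ r c → c < part λ′ r → ¬ (p ∣ hook λ′ r c)

psum : List ℕ → ℕ → ℕ
psum λ′ k = sum (take k λ′)

_⊴_ : List ℕ → List ℕ → Set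
λ′ ⊴ μ = ∀ k → psum λ′ k ≤ psum μ k

-- Abacus: bead positions λ_i - i (i ≥ 1), as a subset of ℤ

BeadSet : Set₁
BeadSet = ℤ → Set

Beads : List ℕ → BeadSet
Beads λ′ x = Σ ℕ (λ k → x ≡ (+ part λ′ k) ℤ.- (+ suc k))

HasAbacus : List ℕ → BeadSet → Set
HasAbacus μ S = ∀ x → (Beads μ x → S x) × (S x → Beads μ x)

move : BeadSet → ℤ → ℤ → BeadSet
move B x y z = (B z × z ≢ x) Data.Sum.⊎ (z ≡ y)
  where import Data.Sum

LowestBead : ℕ → List ℕ → ℤ → Set
LowestBead p λ′ x = Beads λ′ x × (∀ k → ¬ Beads λ′ (x ℤ.+ (+ (suc k * p))))

IsRho : ℕ → List ℕ → (ℕ → ℤ) → Set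
IsRho p γ ρ =
  (∀ r → r < p → LowestBead p γ (ρ r)) ×
  (∀ r s → r < s → s < p → ρ r ℤ.< ρ s) ×
  (∀ x → LowestBead p γ x → ∃ λ r → r < p × ρ r ≡ x)

module Labels (p : ℕ) (γ : List ℕ) (ρ : ℕ → ℤ) where

  P : ℤ
  P = + p

  pairL : ℕ → ℕ → BeadSet
  pairL a b = move (move (Beads γ) (ρ a) (ρ a ℤ.+ P)) (ρ b) (ρ b ℤ.+ P)

  single : ℕ → BeadSet
  single a = move (Beads γ) (ρ a) (ρ a ℤ.+ (+ (2 * p)))

  square : ℕ → BeadSet
  square a = move (move (Beads γ) (ρ a) (ρ a ℤ.+ P)) (ρ a ℤ.- P) (ρ a)

  -- pyramid  ^a γ_b  (a, b ≥ 0 here; the case a < 0 never occurs)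
  pyr : ℕ → ℕ → Bool
  pyr a b = if b <ᵇ a then true
            else if p ≤ᵇ b then false
            else ⌊ (ρ b ℤ.- ρ a) ℤ.<? P ⌋

  ⌈_,_⌋ : ℕ → ℕ → BeadSet
  ⌈ a , b ⌋ =
    if a ≡ᵇ b
      then (if pyr (a + 1) (a + 2) then pairL (a + 1) (a + 2) else single (a + 1))
      else (if not (pyr (a + 1) b) then pairL (a + 1) b
      else (if not (pyr a b) then square b
      else (if not (pyr a (b + 1)) then single a
      else pairL a (b + 1))))

-- Every label ⌈a,b⌋ is the abacus of γ with two beads, at positions u and v, each
-- pushed one position down its runner (⟨a⟩ moves one bead by 2p, which has the
-- same effect on additive statistics as pushing from ρ a and then from ρ a + p).
-- Summing the convex function t ↦ max(t - c, 0) over the bead positions, a push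
-- from u adds max(u + p - c, 0) - max(u - c, 0), which is increasing in u; and if
-- these sums for μ are bounded by those for ν for every c, then μ ⊴ ν. Unwinding
-- the six cases, ⌈a,b⌋ for a < b pushes the beads at clamp(ρ_a, ρ_{a+1}, ρ_b - p)
-- and clamp(ρ_b, ρ_{b+1}, ρ_a + p), while ⌈a,a⌋ pushes those of (a+1, a+1); both
-- positions increase with a and b.
module Submission where

open import Defs

module Dominance where

  open import Data.Bool using (Bool; true; false; _∧_; _∨_; not; T)
  import Data.Bool.Properties as 𝔹ₚ
  open import Data.Empty using (⊥-elim)
  open import Data.List using (List; []; _∷_; length; take)
  open import Data.List.Relation.Unary.Linked using (Linked; []; [-]; _∷_)
  open import Data.Nat as ℕ using (ℕ; zero; suc; z≤n; s≤s; _<ᵇ_; _≤ᵇ_; _≡ᵇ_)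
  import Data.Nat.Properties as ℕₚ
  open import Data.Nat.ListAction using (sum)
  open import Data.Integer as ℤ
    using (ℤ; +_; -[1+_]; _+_; _-_; _*_; -_; _≤_; _<_; ∣_∣; _⊔_; _⊓_; 0ℤ; 1ℤ; -1ℤ)
  import Data.Integer.Properties as ℤₚ
  open import Data.Integer.Tactic.RingSolver using (solve-∀)
  open import Data.Product using (∃-syntax; _×_; _,_; proj₁; proj₂)
  open import Data.Sum using (inj₁; inj₂; [_,_])
  open import Function using (_∘_)
  open import Function.Bundles using (Equivalence)
  open import Relation.Nullary using (¬_; Dec; yes; no; does)
  open import Relation.Nullary.Decidable using (⌊_⌋; map′; dec-true)
  open import Relation.Binary.PropositionalEquality hiding ([_])

  -- Linear inequalities are reduced to a ring identity between the two gaps.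
  ≤-by-gap : ∀ {x y a b : ℤ} → x ≤ y → b - a ≡ y - x → a ≤ b
  ≤-by-gap x≤y eq = ℤₚ.0≤i-j⇒j≤i (subst (0ℤ ≤_) (sym eq) (ℤₚ.i≤j⇒0≤j-i x≤y))

  i+k≤j⇒i≤j-k : ∀ {i j} k → i + k ≤ j → i ≤ j - k
  i+k≤j⇒i≤j-k {i} {j} k h = ≤-by-gap h (lemma i j k)
    where
    lemma : ∀ i j k → (j - k) - i ≡ j - (i + k)
    lemma = solve-∀

  j≤i+k⇒j-k≤i : ∀ {i j} k → j ≤ i + k → j - k ≤ i
  j≤i+k⇒j-k≤i {i} {j} k h = ≤-by-gap h (lemma i j k)
    where
    lemma : ∀ i j k → i - (j - k) ≡ (i + k) - j
    lemma = solve-∀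

  i≤+∣i∣ : ∀ i → i ≤ + ∣ i ∣
  i≤+∣i∣ (+ n)    = ℤₚ.≤-refl
  i≤+∣i∣ -[1+ n ] = ℤ.-≤+

  ∣i∣≤n⇒-n≤i : ∀ {i n} → ∣ i ∣ ℕ.≤ n → - + n ≤ i
  ∣i∣≤n⇒-n≤i {+ _}      _     = ℤₚ.neg-≤-pos
  ∣i∣≤n⇒-n≤i { -[1+ _ ]} 1+m≤n = ℤₚ.neg-mono-≤ (ℤ.+≤+ 1+m≤n)

  -[1+n]<-n : ∀ n → -[1+ n ] < - + n
  -[1+n]<-n n = ℤₚ.neg-mono-< (ℤ.+<+ (ℕₚ.n<1+n n))

  ∣i∣≤∣a∣+∣b∣ : ∀ {a i b} → a ≤ i → i ≤ b → ∣ i ∣ ℕ.≤ ∣ a ∣ ℕ.+ ∣ b ∣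
  ∣i∣≤∣a∣+∣b∣ {a} {+ n} {b} _ i≤b =
    ℕₚ.≤-trans (ℤₚ.drop‿+≤+ (ℤₚ.≤-trans i≤b (i≤+∣i∣ b))) (ℕₚ.m≤n+m ∣ b ∣ ∣ a ∣)
  ∣i∣≤∣a∣+∣b∣ { -[1+ m ]} { -[1+ n ]} (ℤ.-≤- n≤m) _ =
    ℕₚ.≤-trans (s≤s n≤m) (ℕₚ.m≤m+n (suc m) _)

  ∑ : ℕ → (ℕ → ℤ) → ℤ
  ∑ zero    g = 0ℤ
  ∑ (suc n) g = g 0 + ∑ n (g ∘ suc)

  ∑-cong : ∀ n {g h} → (∀ r → r ℕ.< n → g r ≡ h r) → ∑ n g ≡ ∑ n h
  ∑-cong zero    eq = refl
  ∑-cong (suc n) eq = cong₂ _+_ (eq 0 (s≤s z≤n)) (∑-cong n (λ r r<n → eq (suc r) (s≤s r<n)))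

  ∑-mono : ∀ n {g h} → (∀ r → g r ≤ h r) → ∑ n g ≤ ∑ n h
  ∑-mono zero    le = ℤₚ.≤-refl
  ∑-mono (suc n) le = ℤₚ.+-mono-≤ (le 0) (∑-mono n (le ∘ suc))

  ∑-+ : ∀ n g h → ∑ n (λ r → g r + h r) ≡ ∑ n g + ∑ n h
  ∑-+ zero    g h = refl
  ∑-+ (suc n) g h = trans (cong (λ s → (g 0 + h 0) + s) (∑-+ n (g ∘ suc) (h ∘ suc))) (lemma (g 0) (h 0) _ _)
    where
    lemma : ∀ a b c d → (a + b) + (c + d) ≡ (a + c) + (b + d)
    lemma = solve-∀

  ∑-split : ∀ k m g → ∑ (k ℕ.+ m) g ≡ ∑ k g + ∑ m (g ∘ (k ℕ.+_))
  ∑-split zero    m g = sym (ℤₚ.+-identityˡ _)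
  ∑-split (suc k) m g = trans (cong (λ s → g 0 + s) (∑-split k m (g ∘ suc))) (sym (ℤₚ.+-assoc (g 0) _ _))

  ∑-zero : ∀ n {g} → (∀ r → r ℕ.< n → g r ≡ 0ℤ) → ∑ n g ≡ 0ℤ
  ∑-zero zero    _  = refl
  ∑-zero (suc n) eq = cong₂ _+_ (eq 0 (s≤s z≤n)) (∑-zero n (λ r r<n → eq (suc r) (s≤s r<n)))

  ∑-ones : ∀ n → ∑ n (λ _ → 1ℤ) ≡ + n
  ∑-ones zero    = refl
  ∑-ones (suc n) = trans (cong (λ s → 1ℤ + s) (∑-ones n)) (sym (ℤₚ.pos-+ 1 n))

  ∑-nonneg : ∀ n {g} → (∀ r → 0ℤ ≤ g r) → 0ℤ ≤ ∑ n g
  ∑-nonneg n {g} nonneg = subst (_≤ ∑ n g) (∑-zero n (λ _ _ → refl)) (∑-mono n nonneg)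

  ∑-prefix-≤ : ∀ {k n} g → (∀ r → 0ℤ ≤ g r) → k ℕ.≤ n → ∑ k g ≤ ∑ n g
  ∑-prefix-≤ {k} {n} g nonneg k≤n = begin
    ∑ k g                                       ≡⟨ ℤₚ.+-identityʳ _ ⟨
    ∑ k g + 0ℤ
      ≤⟨ ℤₚ.+-monoʳ-≤ (∑ k g) (∑-nonneg (n ℕ.∸ k) (nonneg ∘ (k ℕ.+_))) ⟩
    ∑ k g + ∑ (n ℕ.∸ k) (g ∘ (k ℕ.+_))          ≡⟨ ∑-split k (n ℕ.∸ k) g ⟨
    ∑ (k ℕ.+ (n ℕ.∸ k)) g                       ≡⟨ cong (λ m → ∑ m g) (ℕₚ.m+[n∸m]≡n k≤n) ⟩
    ∑ n g                                       ∎
    where open ℤₚ.≤-Reasoning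

  ∑-prefix-≡ : ∀ {k n} g → (∀ r → k ℕ.≤ r → g r ≡ 0ℤ) → k ℕ.≤ n → ∑ n g ≡ ∑ k g
  ∑-prefix-≡ {k} {n} g zeros k≤n = begin
    ∑ n g                                       ≡⟨ cong (λ m → ∑ m g) (ℕₚ.m+[n∸m]≡n k≤n) ⟨
    ∑ (k ℕ.+ (n ℕ.∸ k)) g                       ≡⟨ ∑-split k (n ℕ.∸ k) g ⟩
    ∑ k g + ∑ (n ℕ.∸ k) (g ∘ (k ℕ.+_))
      ≡⟨ cong (λ s → ∑ k g + s) (∑-zero (n ℕ.∸ k) (λ r _ → zeros (k ℕ.+ r) (ℕₚ.m≤m+n k r))) ⟩
    ∑ k g + 0ℤ                                  ≡⟨ ℤₚ.+-identityʳ _ ⟩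
    ∑ k g                                       ∎
    where open ≡-Reasoning

  hinge : ℤ → ℤ → ℤ
  hinge c t = (t - c) ⊔ 0ℤ

  hinge-below : ∀ {c t} → t ≤ c → hinge c t ≡ 0ℤ
  hinge-below t≤c = ℤₚ.i≤j⇒i⊔j≡j (ℤₚ.i≤j⇒i-j≤0 t≤c)

  hinge-above : ∀ {c t} → c ≤ t → hinge c t ≡ t - c
  hinge-above c≤t = ℤₚ.i≥j⇒i⊔j≡i (ℤₚ.i≤j⇒0≤j-i c≤t)

  hinge-nonneg : ∀ c t → 0ℤ ≤ hinge c t
  hinge-nonneg c t = ℤₚ.i≤j⊔i (t - c) 0ℤ

  hinge-mono : ∀ c {t t'} → t ≤ t' → hinge c t ≤ hinge c t'
  hinge-mono c t≤t' = ℤₚ.⊔-monoˡ-≤ 0ℤ (ℤₚ.+-monoˡ-≤ (- c) t≤t')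

  unitJump : ℤ → ℤ → ℤ
  unitJump c t = hinge c (1ℤ + t) - hinge c t

  unitJump-≥ : ∀ {c t} → c ≤ t → unitJump c t ≡ 1ℤ
  unitJump-≥ {c} {t} c≤t =
    trans (cong₂ _-_ (hinge-above (ℤₚ.≤-trans c≤t (ℤₚ.i≤j+i t 1ℤ))) (hinge-above c≤t)) (lemma c t)
    where
    lemma : ∀ c t → (1ℤ + t - c) - (t - c) ≡ 1ℤ
    lemma = solve-∀

  unitJump-< : ∀ {c t} → t < c → unitJump c t ≡ 0ℤ
  unitJump-< t<c = cong₂ _-_ (hinge-below (ℤₚ.i<j⇒suc[i]≤j t<c)) (hinge-below (ℤₚ.<⇒≤ t<c))

  unitJump-mono : ∀ c {t t'} → t ≤ t' → unitJump c t ≤ unitJump c t'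
  unitJump-mono c {t} {t'} t≤t' with c ℤ.≤? t
  ... | yes c≤t = ℤₚ.≤-reflexive (trans (unitJump-≥ c≤t) (sym (unitJump-≥ (ℤₚ.≤-trans c≤t t≤t'))))
  ... | no  c≰t = subst (_≤ unitJump c t') (sym (unitJump-< (ℤₚ.≰⇒> c≰t)))
                        (ℤₚ.i≤j⇒0≤j-i (hinge-mono c (ℤₚ.i≤j+i t' 1ℤ)))

  jump : ℤ → ℕ → ℤ → ℤ
  jump c s u = hinge c (u + + s) - hinge c u

  jump-suc : ∀ c s u → jump c (suc s) u ≡ jump c s u + unitJump c (u + + s)
  jump-suc c s u = trans (cong (λ t → hinge c t - hinge c u) (shift u (+ s)))
                         (lemma (hinge c (1ℤ + (u + + s))) (hinge c (u + + s)) (hinge c u))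
    where
    shift : ∀ u s → u + (1ℤ + s) ≡ 1ℤ + (u + s)
    shift = solve-∀
    lemma : ∀ a b d → a - d ≡ (b - d) + (a - b)
    lemma = solve-∀

  jump-mono : ∀ c s {u v} → u ≤ v → jump c s u ≤ jump c s v
  jump-mono c zero {u} {v} _ = ℤₚ.≤-reflexive (trans (vanish u) (sym (vanish v)))
    where
    vanish : ∀ u → jump c 0 u ≡ 0ℤ
    vanish u = trans (cong (λ t → hinge c t - hinge c u) (ℤₚ.+-identityʳ u)) (ℤₚ.+-inverseʳ (hinge c u))
  jump-mono c (suc s) {u} {v} u≤v = begin
    jump c (suc s) u                        ≡⟨ jump-suc c s u ⟩
    jump c s u + unitJump c (u + + s)
      ≤⟨ ℤₚ.+-mono-≤ (jump-mono c s u≤v) (unitJump-mono c (ℤₚ.+-monoˡ-≤ (+ s) u≤v)) ⟩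
    jump c s v + unitJump c (v + + s)       ≡⟨ jump-suc c s v ⟨
    jump c (suc s) v                        ∎
    where open ℤₚ.≤-Reasoning

  StrictlyDecreasing : (ℕ → ℤ) → Set
  StrictlyDecreasing e = ∀ r → e (suc r) < e r

  IsTerm : (ℕ → ℤ) → ℤ → Set
  IsTerm e t = ∃[ r ] t ≡ e r

  module _ {e : ℕ → ℤ} (decr : StrictlyDecreasing e) where

    decreasing-by-index : ∀ r → e r + + r ≤ e 0
    decreasing-by-index zero    = ℤₚ.≤-reflexive (ℤₚ.+-identityʳ (e 0))
    decreasing-by-index (suc r) =
      ℤₚ.≤-trans (≤-by-gap (ℤₚ.i<j⇒suc[i]≤j (decr r)) (lemma (e (suc r)) (e r) (+ r)))
                 (decreasing-by-index r)
      where
      lemma : ∀ a b r → (b + r) - (a + (1ℤ + r)) ≡ b - (1ℤ + a)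
      lemma = solve-∀

    decreasing-antitone : ∀ {r s} → r ℕ.≤ s → e s ≤ e r
    decreasing-antitone {s = zero} z≤n = ℤₚ.≤-refl
    decreasing-antitone {r} {suc s} r≤1+s with ℕₚ.m≤n⇒m<n∨m≡n r≤1+s
    ... | inj₁ (s≤s r≤s) = ℤₚ.≤-trans (ℤₚ.<⇒≤ (decr s)) (decreasing-antitone r≤s)
    ... | inj₂ refl      = ℤₚ.≤-refl

    ∈?-decreasing : ∀ t → Dec (IsTerm e t)
    ∈?-decreasing t = map′ (λ (r , _ , t≡er) → r , t≡er) (λ (r , t≡er) → r , bounded r t≡er , t≡er)
                           (ℕₚ.anyUpTo? (λ r → t ℤ.≟ e r) (suc ∣ e 0 - t ∣))
      where
      lemma : ∀ a b r → (a - b) - r ≡ a - (b + r)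
      lemma = solve-∀
      bounded : ∀ r → t ≡ e r → r ℕ.< suc ∣ e 0 - t ∣
      bounded r refl = s≤s (ℤₚ.drop‿+≤+ (ℤₚ.≤-trans r≤gap (i≤+∣i∣ (e 0 - e r))))
        where
        r≤gap = ≤-by-gap (decreasing-by-index r) (lemma (e 0) (e r) (+ r))

  beadPos : List ℕ → ℕ → ℤ
  beadPos μ r = + part μ r - + suc r

  part-antitone : ∀ {μ} → Linked ℕ._≥_ μ → ∀ r → part μ (suc r) ℕ.≤ part μ r
  part-antitone []          r       = z≤n
  part-antitone [-]         r       = z≤n
  part-antitone (x≥y ∷ _)   zero    = x≥y
  part-antitone (_ ∷ sorted) (suc r) = part-antitone sorted r

  beadPos-decreasing : ∀ {μ} → IsPartition μ → StrictlyDecreasing (beadPos μ)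
  beadPos-decreasing {μ} (sorted , _) r =
    ℤₚ.suc[i]≤j⇒i<j (≤-by-gap (ℤ.+≤+ (part-antitone sorted r)) (lemma (+ part μ (suc r)) (+ part μ r) (+ r)))
    where
    lemma : ∀ a b r → (b - (1ℤ + r)) - (1ℤ + (a - (1ℤ + (1ℤ + r)))) ≡ b - a
    lemma = solve-∀

  hingeSum : ℤ → List ℕ → ℕ → ℤ
  hingeSum c μ n = ∑ n (hinge c ∘ beadPos μ)

  +psum≡∑ : ∀ μ k → + psum μ k ≡ ∑ k (λ r → + part μ r)
  +psum≡∑ μ       zero    = refl
  +psum≡∑ []      (suc k) = sym (∑-zero (suc k) (λ _ _ → refl))
  +psum≡∑ (x ∷ μ) (suc k) = trans (ℤₚ.pos-+ x (sum (take k μ))) (cong (λ s → + x + s) (+psum≡∑ μ k))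

  -- With c the k-th bead of ν, hingeSum c ν sums the first k beads of ν minus c,
  -- while hingeSum c μ bounds the same sum for μ.
  ⊴-from-hingeSums : ∀ {μ ν} → IsPartition ν →
                     (∀ c k → ∃[ n ] k ℕ.≤ n × hingeSum c μ n ≤ hingeSum c ν n) → μ ⊴ ν
  ⊴-from-hingeSums _ _ zero = z≤n
  ⊴-from-hingeSums {μ} {ν} Pν hingeSum≤ (suc k) with hingeSum≤ (beadPos ν k) (suc k)
  ... | n , k<n , μ≤ν = ℤₚ.drop‿+≤+ (begin
    + psum μ K                         ≡⟨ split μ ⟩
    ∑ K (shifted μ) + ∑ K base         ≤⟨ ℤₚ.+-monoˡ-≤ (∑ K base) shifted≤ ⟩
    ∑ K (shifted ν) + ∑ K base         ≡⟨ split ν ⟨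
    + psum ν K                         ∎)
    where
    open ℤₚ.≤-Reasoning
    K = suc k
    c = beadPos ν k
    shifted : List ℕ → ℕ → ℤ
    shifted π r = beadPos π r - c
    base : ℕ → ℤ
    base r = c + + suc r
    split : ∀ π → + psum π K ≡ ∑ K (shifted π) + ∑ K base
    split π = trans (+psum≡∑ π K)
      (trans (∑-cong K (λ r _ → lemma (+ part π r) (+ suc r) c)) (∑-+ K (shifted π) base))
      where
      lemma : ∀ a b c → a ≡ ((a - b) - c) + (c + b)
      lemma = solve-∀
    ν-decr = beadPos-decreasing Pν
    shifted≤ : ∑ K (shifted μ) ≤ ∑ K (shifted ν)
    shifted≤ = begin
      ∑ K (shifted μ)    ≤⟨ ∑-mono K (λ r → ℤₚ.i≤i⊔j (shifted μ r) 0ℤ) ⟩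
      hingeSum c μ K     ≤⟨ ∑-prefix-≤ (hinge c ∘ beadPos μ) (λ r → hinge-nonneg c (beadPos μ r)) k<n ⟩
      hingeSum c μ n     ≤⟨ μ≤ν ⟩
      hingeSum c ν n     ≡⟨ ∑-prefix-≡ (hinge c ∘ beadPos ν)
                              (λ r K≤r → hinge-below (decreasing-antitone ν-decr (ℕₚ.<⇒≤ K≤r))) k<n ⟩
      hingeSum c ν K     ≡⟨ ∑-cong K (λ r r<K →
                                hinge-above (decreasing-antitone ν-decr (ℕₚ.≤-pred r<K))) ⟩
      ∑ K (shifted ν)    ∎

  ∑-update : ∀ n {g g' m} → m ℕ.< n → (∀ r → r ≢ m → g' r ≡ g r) → ∑ n g' ≡ ∑ n g + (g' m - g m)
  ∑-update (suc n) {g} {g'} {zero} _ agree =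
    trans (cong (λ s → g' 0 + s) (∑-cong n (λ r _ → agree (suc r) λ ()))) (lemma (g' 0) (g 0) _)
    where
    lemma : ∀ a b s → a + s ≡ (b + s) + (a - b)
    lemma = solve-∀
  ∑-update (suc n) {g} {g'} {suc m} (s≤s m<n) agree =
    trans (cong₂ _+_ (agree 0 λ ()) (∑-update n m<n (λ r r≢m → agree (suc r) (r≢m ∘ ℕₚ.suc-injective))))
          (sym (ℤₚ.+-assoc (g 0) _ _))

  ⟦_⟧ : Bool → ℤ
  ⟦ true  ⟧ = 1ℤ
  ⟦ false ⟧ = 0ℤ

  windowSum : (ℤ → ℤ) → (ℤ → Bool) → ℤ → ℕ → ℤ
  windowSum f χ H n = ∑ n (λ m → f (H - + m) * ⟦ χ (H - + m) ⟧)

  data InWindow : ℤ → ℤ → ℕ → Set where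
    at : ∀ {H n} m → m ℕ.< n → InWindow (H - + m) H n

  windowSum-cong : ∀ f {χ χ'} H n → (∀ t → χ t ≡ χ' t) → windowSum f χ H n ≡ windowSum f χ' H n
  windowSum-cong f H n eq = ∑-cong n (λ m _ → cong (λ b → f (H - + m) * ⟦ b ⟧) (eq (H - + m)))

  windowSum-update : ∀ f χ χ' {x H n} → InWindow x H n → (∀ t → t ≢ x → χ' t ≡ χ t) →
                     windowSum f χ' H n ≡ windowSum f χ H n + f x * (⟦ χ' x ⟧ - ⟦ χ x ⟧)
  windowSum-update f χ χ' {H = H} {n} (at m m<n) agree =
    trans (∑-update n m<n (λ r r≢m → cong (λ b → f (H - + r) * ⟦ b ⟧)
                                          (agree (H - + r) (r≢m ∘ offsets-injective))))
          (cong (λ s → windowSum f χ H n + s) (lemma (f (H - + m)) ⟦ χ' (H - + m) ⟧ ⟦ χ (H - + m) ⟧))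
    where
    offsets-injective : ∀ {r} → H - + r ≡ H - + m → r ≡ m
    offsets-injective {r} eq =
      ℤₚ.+-injective (trans (undo H (+ r)) (trans (cong (λ t → H - t) eq) (sym (undo H (+ m)))))
      where
      undo : ∀ h x → x ≡ h - (h - x)
      undo = solve-∀
    lemma : ∀ a b c → a * b - a * c ≡ a * (b - c)
    lemma = solve-∀

  windowSum-update₂ : ∀ f χ χ' {x y H n} → x ≢ y → InWindow x H n → InWindow y H n →
                      (∀ t → t ≢ x → t ≢ y → χ' t ≡ χ t) →
                      windowSum f χ' H n ≡
                        (windowSum f χ H n + f x * (⟦ χ' x ⟧ - ⟦ χ x ⟧)) + f y * (⟦ χ' y ⟧ - ⟦ χ y ⟧)
  windowSum-update₂ f χ χ' {x} {y} {H} {n} x≢y x∈ y∈ agree = begin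
    windowSum f χ' H n
      ≡⟨ windowSum-update f χ₁ χ' y∈ (λ t t≢y → sym (χ'-off-y t≢y)) ⟩
    windowSum f χ₁ H n + f y * (⟦ χ' y ⟧ - ⟦ χ₁ y ⟧)
      ≡⟨ cong₂ (λ w b → w + f y * (⟦ χ' y ⟧ - ⟦ b ⟧))
               (windowSum-update f χ χ₁ x∈ χ₁-off-x) (χ₁-at y refl) ⟩
    (windowSum f χ H n + f x * (⟦ χ₁ x ⟧ - ⟦ χ x ⟧)) + f y * (⟦ χ' y ⟧ - ⟦ χ y ⟧)
      ≡⟨ cong (λ b → (windowSum f χ H n + f x * (⟦ b ⟧ - ⟦ χ x ⟧)) + f y * (⟦ χ' y ⟧ - ⟦ χ y ⟧))
              (χ'-off-y x≢y) ⟩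
    (windowSum f χ H n + f x * (⟦ χ' x ⟧ - ⟦ χ x ⟧)) + f y * (⟦ χ' y ⟧ - ⟦ χ y ⟧) ∎
    where
    open ≡-Reasoning
    χ₁ : ℤ → Bool
    χ₁ t with t ℤ.≟ y
    ... | yes _ = χ t
    ... | no  _ = χ' t
    χ₁-at : ∀ t → t ≡ y → χ₁ t ≡ χ t
    χ₁-at t t≡y with t ℤ.≟ y
    ... | yes _   = refl
    ... | no  t≢y = ⊥-elim (t≢y t≡y)
    χ'-off-y : ∀ {t} → t ≢ y → χ₁ t ≡ χ' t
    χ'-off-y {t} t≢y with t ℤ.≟ y
    ... | yes t≡y = ⊥-elim (t≢y t≡y)
    ... | no  _   = refl
    χ₁-off-x : ∀ t → t ≢ x → χ₁ t ≡ χ t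
    χ₁-off-x t t≢x with t ℤ.≟ y
    ... | yes _   = refl
    ... | no  t≢y = agree t t≢x t≢y

  moveᵇ : (ℤ → Bool) → ℤ → ℤ → ℤ → Bool
  moveᵇ χ x y t = (χ t ∧ not ⌊ t ℤ.≟ x ⌋) ∨ ⌊ t ℤ.≟ y ⌋

  moveᵇ-target : ∀ χ x y → moveᵇ χ x y y ≡ true
  moveᵇ-target χ x y with y ℤ.≟ y
  ... | yes _   = 𝔹ₚ.∨-zeroʳ _
  ... | no  y≢y = ⊥-elim (y≢y refl)

  moveᵇ-source : ∀ χ {x y} → x ≢ y → moveᵇ χ x y x ≡ false
  moveᵇ-source χ {x} {y} x≢y with x ℤ.≟ x | x ℤ.≟ y
  ... | yes _   | no _    = trans (𝔹ₚ.∨-identityʳ _) (𝔹ₚ.∧-zeroʳ (χ x))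
  ... | no  x≢x | _       = ⊥-elim (x≢x refl)
  ... | _       | yes x≡y = ⊥-elim (x≢y x≡y)

  moveᵇ-elsewhere : ∀ χ {x y t} → t ≢ x → t ≢ y → moveᵇ χ x y t ≡ χ t
  moveᵇ-elsewhere χ {x} {y} {t} t≢x t≢y with t ℤ.≟ x | t ℤ.≟ y
  ... | no _    | no _    = trans (𝔹ₚ.∨-identityʳ _) (𝔹ₚ.∧-identityʳ (χ t))
  ... | yes t≡x | _       = ⊥-elim (t≢x t≡x)
  ... | _       | yes t≡y = ⊥-elim (t≢y t≡y)

  windowSum-moveᵇ : ∀ f χ {x y H n} → x ≢ y → InWindow x H n → InWindow y H n →
                    windowSum f (moveᵇ χ x y) H n ≡
                      (windowSum f χ H n + f x * (0ℤ - ⟦ χ x ⟧)) + f y * (1ℤ - ⟦ χ y ⟧)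
  windowSum-moveᵇ f χ {x} {y} {H} {n} x≢y x∈ y∈ =
    trans (windowSum-update₂ f χ (moveᵇ χ x y) x≢y x∈ y∈ (λ t → moveᵇ-elsewhere χ))
          (cong₂ (λ a b → (windowSum f χ H n + f x * (⟦ a ⟧ - ⟦ χ x ⟧)) + f y * (⟦ b ⟧ - ⟦ χ y ⟧))
                 (moveᵇ-source χ x≢y) (moveᵇ-target χ x y))

  bead≢hole : ∀ (χ : ℤ → Bool) {a b} → χ a ≡ true → χ b ≡ false → a ≢ b
  bead≢hole χ bead hole refl with trans (sym bead) hole
  ... | ()

  windowSum-move-bead : ∀ f χ {x y H n} → χ x ≡ true → χ y ≡ false → InWindow x H n → InWindow y H n →
                        windowSum f (moveᵇ χ x y) H n ≡ windowSum f χ H n + (f y - f x)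
  windowSum-move-bead f χ {x} {y} {H} {n} bead hole x∈ y∈ =
    trans (windowSum-moveᵇ f χ (bead≢hole χ bead hole) x∈ y∈)
          (trans (cong₂ (λ a b → (windowSum f χ H n + f x * (0ℤ - ⟦ a ⟧)) + f y * (1ℤ - ⟦ b ⟧)) bead hole)
                 (lemma (windowSum f χ H n) (f x) (f y)))
    where
    lemma : ∀ w a b → (w + a * (0ℤ - 1ℤ)) + b * (1ℤ - 0ℤ) ≡ w + (b - a)
    lemma = solve-∀

  Represents : (ℤ → Bool) → BeadSet → Set
  Represents χ S = ∀ t → (χ t ≡ true → S t) × (S t → χ t ≡ true)

  represents-unique : ∀ {χ χ' S} → Represents χ S → Represents χ' S → ∀ t → χ t ≡ χ' t
  represents-unique {χ} {χ'} rep rep' t with χ t in eq | χ' t in eq'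
  ... | true  | true  = refl
  ... | false | false = refl
  ... | true  | false = trans (sym (proj₂ (rep' t) (proj₁ (rep t) eq))) eq'
  ... | false | true  = trans (sym eq) (proj₂ (rep t) (proj₁ (rep' t) eq'))

  represents-abacus : ∀ {χ S μ} → Represents χ S → HasAbacus μ S → Represents χ (Beads μ)
  represents-abacus rep abacus t = proj₂ (abacus t) ∘ proj₁ (rep t) , proj₂ (rep t) ∘ proj₁ (abacus t)

  moveᵇ-represents : ∀ {χ S} x y → Represents χ S → Represents (moveᵇ χ x y) (move S x y)
  moveᵇ-represents {χ} x y rep t with t ℤ.≟ y | t ℤ.≟ x
  ... | yes t≡y | _       = (λ _ → inj₂ t≡y) , (λ _ → 𝔹ₚ.∨-zeroʳ _)
  ... | no  t≢y | yes t≡x =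
      (λ eq → ⊥-elim (false≢true eq))
    , [ (λ (_ , t≢x) → ⊥-elim (t≢x t≡x)) , ⊥-elim ∘ t≢y ]
    where
    false≢true : (χ t ∧ false) ∨ false ≢ true
    false≢true eq with trans (sym (trans (𝔹ₚ.∨-identityʳ _) (𝔹ₚ.∧-zeroʳ (χ t)))) eq
    ... | ()
  ... | no  t≢y | no  t≢x =
      (λ eq → inj₁ (proj₁ (rep t) (trans (sym unfold) eq) , t≢x))
    , [ (λ (s , _) → trans unfold (proj₂ (rep t) s)) , ⊥-elim ∘ t≢y ]
    where
    unfold : (χ t ∧ true) ∨ false ≡ χ t
    unfold = trans (𝔹ₚ.∨-identityʳ _) (𝔹ₚ.∧-identityʳ (χ t))

  RepresentsUpTo : ℤ → (ℤ → Bool) → BeadSet → Set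
  RepresentsUpTo H χ S = ∀ t → t ≤ H → (χ t ≡ true → S t) × (S t → χ t ≡ true)

  pred-offset : ∀ H m → H - + suc m ≡ ℤ.pred H - + m
  pred-offset H m = lemma H (+ m)
    where
    lemma : ∀ h m → h - (1ℤ + m) ≡ (-1ℤ + h) - m
    lemma = solve-∀

  windowSum-suc : ∀ f χ H n → windowSum f χ H (suc n) ≡ f H * ⟦ χ H ⟧ + windowSum f χ (ℤ.pred H) n
  windowSum-suc f χ H n = cong₂ _+_ (cong (λ t → f t * ⟦ χ t ⟧) (ℤₚ.+-identityʳ H))
                                    (∑-cong n (λ m _ → cong (λ t → f t * ⟦ χ t ⟧) (pred-offset H m)))

  represents-tail : ∀ {e χ} → RepresentsUpTo (e 0) χ (IsTerm e) →
                    RepresentsUpTo (ℤ.pred (e 0)) χ (IsTerm (e ∘ suc))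
  represents-tail {e} {χ} rep t t≤ = from , λ (r , t≡) → proj₂ (rep t t≤e0) (suc r , t≡)
    where
    t≤e0 = ℤₚ.<⇒≤ (ℤₚ.i≤pred[j]⇒i<j t≤)
    from : χ t ≡ true → IsTerm (e ∘ suc) t
    from χt with proj₁ (rep t t≤e0) χt
    ... | zero  , refl = ⊥-elim (ℤₚ.<-irrefl refl (ℤₚ.i≤pred[j]⇒i<j t≤))
    ... | suc r , t≡   = r , t≡

  no-term-above : ∀ {e χ H} → StrictlyDecreasing e → e 0 < H → RepresentsUpTo H χ (IsTerm e) → χ H ≡ false
  no-term-above {e} {χ} {H} decr e0<H rep with χ H in χH
  ... | false = refl
  ... | true with proj₁ (rep H ℤₚ.≤-refl) χH
  ...   | r , refl = ⊥-elim (ℤₚ.<-irrefl refl (ℤₚ.≤-<-trans (decreasing-antitone decr z≤n) e0<H))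

  windowSum-decreasing : ∀ f n {e χ H} → StrictlyDecreasing e → e 0 ≤ H → RepresentsUpTo H χ (IsTerm e) →
                         (∀ t → t ≤ H - + n → f t ≡ 0ℤ) → windowSum f χ H n ≡ ∑ n (f ∘ e)
  windowSum-decreasing f zero _ _ _ _ = refl
  windowSum-decreasing f (suc n) {e} {χ} {H} decr e0≤H rep vanish with e 0 ℤ.≟ H
  ... | yes refl = begin
    windowSum f χ (e 0) (suc n)                          ≡⟨ windowSum-suc f χ (e 0) n ⟩
    f (e 0) * ⟦ χ (e 0) ⟧ + windowSum f χ (ℤ.pred (e 0)) n
      ≡⟨ cong₂ (λ b w → f (e 0) * ⟦ b ⟧ + w) (proj₂ (rep (e 0) ℤₚ.≤-refl) (0 , refl)) tail ⟩
    f (e 0) * 1ℤ + ∑ n (f ∘ e ∘ suc)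
      ≡⟨ cong (λ s → s + ∑ n (f ∘ e ∘ suc)) (ℤₚ.*-identityʳ (f (e 0))) ⟩
    ∑ (suc n) (f ∘ e)                                    ∎
    where
    open ≡-Reasoning
    tail : windowSum f χ (ℤ.pred (e 0)) n ≡ ∑ n (f ∘ e ∘ suc)
    tail = windowSum-decreasing f n (decr ∘ suc) (ℤₚ.i<j⇒i≤pred[j] (decr 0)) (represents-tail rep)
             (λ t t≤ → vanish t (subst (t ≤_) (sym (pred-offset (e 0) n)) t≤))
  ... | no e0≢H = begin
    windowSum f χ H (suc n)                              ≡⟨ windowSum-suc f χ H n ⟩
    f H * ⟦ χ H ⟧ + windowSum f χ (ℤ.pred H) n
      ≡⟨ cong₂ (λ b w → f H * ⟦ b ⟧ + w) (no-term-above decr e0<H rep) tail ⟩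
    f H * 0ℤ + ∑ n (f ∘ e)
      ≡⟨ trans (cong (λ s → s + ∑ n (f ∘ e)) (ℤₚ.*-zeroʳ (f H))) (ℤₚ.+-identityˡ _) ⟩
    ∑ n (f ∘ e)                                          ≡⟨ ∑-prefix-≡ (f ∘ e) beyond-n (ℕₚ.n≤1+n n) ⟨
    ∑ (suc n) (f ∘ e)                                    ∎
    where
    open ≡-Reasoning
    e0<H = ℤₚ.≤∧≢⇒< e0≤H e0≢H
    tail : windowSum f χ (ℤ.pred H) n ≡ ∑ n (f ∘ e)
    tail = windowSum-decreasing f n decr (ℤₚ.i<j⇒i≤pred[j] e0<H)
             (λ t t≤ → rep t (ℤₚ.<⇒≤ (ℤₚ.i≤pred[j]⇒i<j t≤)))
             (λ t t≤ → vanish t (subst (t ≤_) (sym (pred-offset H n)) t≤))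
    beyond-n : ∀ r → n ℕ.≤ r → f (e r) ≡ 0ℤ
    beyond-n r n≤r = vanish (e r) (ℤₚ.≤-trans (decreasing-antitone decr n≤r)
                                   (≤-by-gap (ℤₚ.+-mono-≤ (decreasing-by-index decr n)
                                                          (ℤₚ.i<j⇒i≤pred[j] e0<H))
                                             (lemma (e 0) (e n) H (+ n))))
      where
      lemma : ∀ a b h n → (h - (1ℤ + n)) - b ≡ (a + (-1ℤ + h)) - ((b + n) + a)
      lemma = solve-∀

  decided : ∀ {A : Set} (a? : Dec A) → does a? ≡ true → A
  decided (yes a) _ = a

  beadsᵇ : (μ : List ℕ) → IsPartition μ → ℤ → Bool
  beadsᵇ μ Pμ t = does (∈?-decreasing (beadPos-decreasing Pμ) t)

  beadsᵇ-represents : ∀ μ Pμ → Represents (beadsᵇ μ Pμ) (Beads μ)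
  beadsᵇ-represents μ Pμ t = decided t∈? , dec-true t∈?
    where t∈? = ∈?-decreasing (beadPos-decreasing Pμ) t

  width : ℕ → ℕ
  width B = suc (B ℕ.+ B)

  window : (ℤ → ℤ) → (ℤ → Bool) → ℕ → ℤ
  window f χ B = windowSum f χ (+ B) (width B)

  inWindow : ∀ {x B} → ∣ x ∣ ℕ.≤ B → InWindow x (+ B) (width B)
  inWindow {+ k} {B} k≤B =
    subst (λ x → InWindow x (+ B) (width B))
          (trans (cong (λ m → + m - + (B ℕ.∸ k)) (sym (ℕₚ.m+[n∸m]≡n k≤B)))
                 (sym (lemma (+ k) (+ (B ℕ.∸ k)))))
          (at (B ℕ.∸ k) (s≤s (ℕₚ.≤-trans (ℕₚ.m∸n≤m B k) (ℕₚ.m≤m+n B B))))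
    where
    lemma : ∀ k d → k ≡ (k + d) - d
    lemma = solve-∀
  inWindow { -[1+ k ]} {B} k<B =
    subst (λ x → InWindow x (+ B) (width B)) (sym (lemma (+ B) (+ k)))
          (at (B ℕ.+ suc k) (s≤s (ℕₚ.+-monoʳ-≤ B k<B)))
    where
    lemma : ∀ b k → - (1ℤ + k) ≡ b - (b + (1ℤ + k))
    lemma = solve-∀

  window-beads : ∀ f μ Pμ {B} → part μ 0 ℕ.≤ B → (∀ t → t ≤ -[1+ B ] → f t ≡ 0ℤ) →
                 window f (beadsᵇ μ Pμ) B ≡ ∑ (width B) (f ∘ beadPos μ)
  window-beads f μ Pμ {B} part≤B vanish =
    windowSum-decreasing f (width B) (beadPos-decreasing Pμ) first≤B (λ t _ → beadsᵇ-represents μ Pμ t)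
      (λ t t≤ → vanish t (subst (t ≤_) (lemma (+ B)) t≤))
    where
    first≤B : beadPos μ 0 ≤ + B
    first≤B = ℤₚ.≤-trans (ℤₚ.i-j≤i (+ part μ 0) 1ℤ) (ℤ.+≤+ part≤B)
    lemma : ∀ b → b - (1ℤ + (b + b)) ≡ - (1ℤ + b)
    lemma = solve-∀

  part-beyond-length : ∀ μ {r} → length μ ℕ.≤ r → part μ r ≡ 0
  part-beyond-length []      _         = refl
  part-beyond-length (_ ∷ μ) (s≤s len≤r) = part-beyond-length μ len≤r

  -- unitJump (- B) is the indicator of [-B, ∞), which holds the first B beads of μ.
  window-count : ∀ μ Pμ {B} → part μ 0 ℕ.≤ B → length μ ℕ.≤ B →
                 window (unitJump (- + B)) (beadsᵇ μ Pμ) B ≡ + B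
  window-count μ Pμ {B} part≤B len≤B = begin
    window (unitJump (- + B)) (beadsᵇ μ Pμ) B
      ≡⟨ window-beads _ μ Pμ part≤B (λ t t≤ → unitJump-< (ℤₚ.≤-<-trans t≤ (-[1+n]<-n B))) ⟩
    ∑ (width B) (unitJump (- + B) ∘ beadPos μ)
      ≡⟨ ∑-prefix-≡ _ outside (ℕₚ.≤-trans (ℕₚ.m≤m+n B B) (ℕₚ.n≤1+n _)) ⟩
    ∑ B (unitJump (- + B) ∘ beadPos μ)               ≡⟨ ∑-cong B inside ⟩
    ∑ B (λ _ → 1ℤ)                                   ≡⟨ ∑-ones B ⟩
    + B                                              ∎
    where
    open ≡-Reasoning
    outside : ∀ r → B ℕ.≤ r → unitJump (- + B) (beadPos μ r) ≡ 0ℤ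
    outside r B≤r rewrite part-beyond-length μ (ℕₚ.≤-trans len≤B B≤r) =
      unitJump-< { - + B} {beadPos [] r} (ℤₚ.suc[i]≤j⇒i<j (≤-by-gap (ℤ.+≤+ B≤r) (lemma (+ B) (+ r))))
      where
      lemma : ∀ b r → - b - (1ℤ + (0ℤ - (1ℤ + r))) ≡ r - b
      lemma = solve-∀
    inside : ∀ r → r ℕ.< B → unitJump (- + B) (beadPos μ r) ≡ 1ℤ
    inside r r<B = unitJump-≥ { - + B} {beadPos μ r} (ℤₚ.≤-trans (ℤₚ.neg-mono-≤ (ℤ.+≤+ r<B))
                     (subst (_≤ beadPos μ r) (ℤₚ.+-identityˡ (- + suc r))
                            (ℤₚ.+-monoˡ-≤ (- + suc r) (ℤ.+≤+ (z≤n {part μ r})))))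

  clamp : ℤ → ℤ → ℤ → ℤ
  clamp lo hi x = lo ⊔ (hi ⊓ x)

  clamp-mono : ∀ {lo lo' hi hi' x x'} → lo ≤ lo' → hi ≤ hi' → x ≤ x' → clamp lo hi x ≤ clamp lo' hi' x'
  clamp-mono lo≤ hi≤ x≤ = ℤₚ.⊔-mono-≤ lo≤ (ℤₚ.⊓-mono-≤ hi≤ x≤)

  clamp-below : ∀ {lo hi x} → x ≤ lo → clamp lo hi x ≡ lo
  clamp-below {lo} {hi} {x} x≤lo = ℤₚ.i≥j⇒i⊔j≡i (ℤₚ.≤-trans (ℤₚ.i⊓j≤j hi x) x≤lo)

  clamp-inside : ∀ {lo hi x} → lo ≤ x → x ≤ hi → clamp lo hi x ≡ x
  clamp-inside lo≤x x≤hi = trans (cong (_ ⊔_) (ℤₚ.i≥j⇒i⊓j≡j x≤hi)) (ℤₚ.i≤j⇒i⊔j≡j lo≤x)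

  clamp-above : ∀ {lo hi x} → lo ≤ hi → hi ≤ x → clamp lo hi x ≡ hi
  clamp-above lo≤hi hi≤x = trans (cong (_ ⊔_) (ℤₚ.i≤j⇒i⊓j≡i hi≤x)) (ℤₚ.i≤j⇒i⊔j≡j lo≤hi)

  T-from-≡ : ∀ {b} → b ≡ true → T b
  T-from-≡ = Equivalence.from 𝔹ₚ.T-≡

  ≡ᵇ-refl : ∀ m → (m ≡ᵇ m) ≡ true
  ≡ᵇ-refl m = Equivalence.to 𝔹ₚ.T-≡ (ℕₚ.≡⇒≡ᵇ m m refl)

  ≡ᵇ-false : ∀ {m n} → m ≢ n → (m ≡ᵇ n) ≡ false
  ≡ᵇ-false {m} {n} m≢n with m ≡ᵇ n in m≡ᵇn
  ... | false = refl
  ... | true  = ⊥-elim (m≢n (ℕₚ.≡ᵇ⇒≡ m n (T-from-≡ m≡ᵇn)))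

  ≤ᵇ-false⇒> : ∀ {m n} → (m ≤ᵇ n) ≡ false → n ℕ.< m
  ≤ᵇ-false⇒> {m} {n} m≰ᵇn = ℕₚ.≰⇒> (λ m≤n → subst T m≰ᵇn (ℕₚ.≤⇒≤ᵇ m≤n))

  module CoreAbacus (p : ℕ) (γ : List ℕ) (Pγ : IsPartition γ) (ρ : ℕ → ℤ) (R : IsRho p γ ρ) where

    open Labels p γ ρ

    χγ : ℤ → Bool
    χγ = beadsᵇ γ Pγ

    ρ-increasing : ∀ {r s} → r ℕ.< s → s ℕ.< p → ρ r < ρ s
    ρ-increasing = proj₁ (proj₂ R) _ _

    ρ-mono : ∀ {r s} → r ℕ.≤ s → s ℕ.< p → ρ r ≤ ρ s
    ρ-mono r≤s s<p with ℕₚ.m≤n⇒m<n∨m≡n r≤s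
    ... | inj₁ r<s  = ℤₚ.<⇒≤ (ρ-increasing r<s s<p)
    ... | inj₂ refl = ℤₚ.≤-refl

    bead-at-ρ : ∀ {r} → r ℕ.< p → χγ (ρ r) ≡ true
    bead-at-ρ r<p = proj₂ (beadsᵇ-represents γ Pγ _) (proj₁ (proj₁ R _ r<p))

    hole-below-ρ : ∀ {r} → r ℕ.< p → ∀ k → χγ (ρ r + + (suc k ℕ.* p)) ≡ false
    hole-below-ρ {r} r<p k with χγ (ρ r + + (suc k ℕ.* p)) in χ≡
    ... | false = refl
    ... | true  = ⊥-elim (proj₂ (proj₁ R r r<p) k (proj₁ (beadsᵇ-represents γ Pγ _) χ≡))

    hole-at-ρ+P : ∀ {r} → r ℕ.< p → χγ (ρ r + P) ≡ false
    hole-at-ρ+P {r} r<p = subst (λ m → χγ (ρ r + + m) ≡ false) (ℕₚ.+-identityʳ p) (hole-below-ρ r<p 0)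

    below-last : ∀ {r} → r ℕ.< p → r ℕ.≤ p ℕ.∸ 1
    below-last (s≤s r≤) = r≤

    last<p : ∀ {r} → r ℕ.< p → p ℕ.∸ 1 ℕ.< p
    last<p (s≤s _) = ℕₚ.n<1+n _

    ρ-spread : ℕ
    ρ-spread = ∣ ρ 0 ∣ ℕ.+ ∣ ρ (p ℕ.∸ 1) ∣ ℕ.+ 2 ℕ.* p

    reach : ℕ
    reach = ρ-spread ℕ.+ (part γ 0 ℕ.+ length γ)

    reach-part : ∀ {B} → reach ℕ.≤ B → part γ 0 ℕ.≤ B
    reach-part = ℕₚ.≤-trans (ℕₚ.m≤n⇒m≤o+n ρ-spread (ℕₚ.m≤m+n (part γ 0) (length γ)))

    reach-length : ∀ {B} → reach ℕ.≤ B → length γ ℕ.≤ B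
    reach-length = ℕₚ.≤-trans (ℕₚ.m≤n⇒m≤o+n ρ-spread (ℕₚ.m≤n+m (length γ) (part γ 0)))

    near-ρ : ∀ {r B} d → r ℕ.< p → ∣ d ∣ ℕ.≤ 2 ℕ.* p → reach ℕ.≤ B → ∣ ρ r + d ∣ ℕ.≤ B
    near-ρ {r} d r<p d≤2p reach≤B = begin
      ∣ ρ r + d ∣                               ≤⟨ ℤₚ.∣i+j∣≤∣i∣+∣j∣ (ρ r) d ⟩
      ∣ ρ r ∣ ℕ.+ ∣ d ∣                         ≤⟨ ℕₚ.+-mono-≤ ρr-bound d≤2p ⟩
      ρ-spread                                  ≤⟨ ℕₚ.m≤m+n ρ-spread _ ⟩
      reach                                     ≤⟨ reach≤B ⟩
      _                                         ∎
      where
      open ℕₚ.≤-Reasoning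
      ρr-bound : ∣ ρ r ∣ ℕ.≤ ∣ ρ 0 ∣ ℕ.+ ∣ ρ (p ℕ.∸ 1) ∣
      ρr-bound = ∣i∣≤∣a∣+∣b∣ (ρ-mono z≤n r<p) (ρ-mono (below-last r<p) (last<p r<p))

    near-ρ-in-window : ∀ {r B} d → r ℕ.< p → ∣ d ∣ ℕ.≤ 2 ℕ.* p → reach ℕ.≤ B →
                       InWindow (ρ r + d) (+ B) (width B)
    near-ρ-in-window d r<p d≤2p reach≤B = inWindow (near-ρ d r<p d≤2p reach≤B)

    ρ-in-window : ∀ {r B} → r ℕ.< p → reach ℕ.≤ B → InWindow (ρ r) (+ B) (width B)
    ρ-in-window {r} {B} r<p reach≤B =
      subst (λ x → InWindow x (+ B) (width B)) (ℤₚ.+-identityʳ (ρ r)) (near-ρ-in-window 0ℤ r<p z≤n reach≤B)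

    P≤2P : ∣ P ∣ ℕ.≤ 2 ℕ.* p
    P≤2P = ℕₚ.m≤m+n p (p ℕ.+ 0)

    step : (ℤ → ℤ) → ℤ → ℤ
    step f u = f (u + P) - f u

    -- S is the abacus of γ with the beads at u and v pushed one position down,
    -- as far as window sums can tell; a bead moved twice counts as two pushes.
    record Pushes (S : BeadSet) (u v : ℤ) : Set₁ where
      field
        χ          : ℤ → Bool
        represents : Represents χ S
        window-≡   : ∀ f {B} → reach ℕ.≤ B → window f χ B ≡ window f χγ B + (step f u + step f v)

    pair-pushes : ∀ {x y} → x ℕ.< y → y ℕ.< p → Pushes (pairL x y) (ρ x) (ρ y)
    pair-pushes {x} {y} x<y y<p = record
      { χ          = moveᵇ χ₁ (ρ y) (ρ y + P)
      ; represents = moveᵇ-represents _ _ (moveᵇ-represents _ _ (beadsᵇ-represents γ Pγ))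
      ; window-≡   = λ f reach≤B → begin
          window f (moveᵇ χ₁ (ρ y) (ρ y + P)) _
            ≡⟨ windowSum-move-bead f χ₁ y-bead y-hole
                 (ρ-in-window y<p reach≤B) (near-ρ-in-window P y<p P≤2P reach≤B) ⟩
          window f χ₁ _ + step f (ρ y)
            ≡⟨ cong (λ w → w + step f (ρ y))
                    (windowSum-move-bead f χγ (bead-at-ρ x<p) (hole-at-ρ+P x<p)
                       (ρ-in-window x<p reach≤B) (near-ρ-in-window P x<p P≤2P reach≤B)) ⟩
          (window f χγ _ + step f (ρ x)) + step f (ρ y)
            ≡⟨ ℤₚ.+-assoc (window f χγ _) _ _ ⟩
          window f χγ _ + (step f (ρ x) + step f (ρ y)) ∎ }
      where
      open ≡-Reasoning
      x<p = ℕₚ.<-trans x<y y<p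
      χ₁ = moveᵇ χγ (ρ x) (ρ x + P)
      ρx<ρy = ρ-increasing x<y y<p
      y-bead : χ₁ (ρ y) ≡ true
      y-bead = trans (moveᵇ-elsewhere χγ (≢-sym (ℤₚ.<⇒≢ ρx<ρy))
                                         (bead≢hole χγ (bead-at-ρ y<p) (hole-at-ρ+P x<p)))
                     (bead-at-ρ y<p)
      y-hole : χ₁ (ρ y + P) ≡ false
      y-hole = trans (moveᵇ-elsewhere χγ (≢-sym (bead≢hole χγ (bead-at-ρ x<p) (hole-at-ρ+P y<p)))
                                         (≢-sym (ℤₚ.<⇒≢ (ℤₚ.+-monoˡ-< P ρx<ρy))))
                     (hole-at-ρ+P y<p)

    two-steps : ∀ x → ρ x + + (2 ℕ.* p) ≡ (ρ x + P) + P
    two-steps x = trans (cong (λ m → ρ x + + (p ℕ.+ m)) (ℕₚ.+-identityʳ p)) (sym (ℤₚ.+-assoc (ρ x) P P))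

    single-pushes : ∀ {x} → x ℕ.< p → Pushes (single x) (ρ x) (ρ x + P)
    single-pushes {x} x<p = record
      { χ          = moveᵇ χγ (ρ x) (ρ x + + (2 ℕ.* p))
      ; represents = moveᵇ-represents _ _ (beadsᵇ-represents γ Pγ)
      ; window-≡   = λ f reach≤B → begin
          window f (moveᵇ χγ (ρ x) (ρ x + + (2 ℕ.* p))) _
            ≡⟨ windowSum-move-bead f χγ (bead-at-ρ x<p) (hole-below-ρ x<p 1)
                 (ρ-in-window x<p reach≤B) (near-ρ-in-window (+ (2 ℕ.* p)) x<p ℕₚ.≤-refl reach≤B) ⟩
          window f χγ _ + (f (ρ x + + (2 ℕ.* p)) - f (ρ x))
            ≡⟨ cong (λ t → window f χγ _ + (f t - f (ρ x))) (two-steps x) ⟩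
          window f χγ _ + (f ((ρ x + P) + P) - f (ρ x))
            ≡⟨ cong (λ s → window f χγ _ + s) (telescope (f ((ρ x + P) + P)) (f (ρ x + P)) (f (ρ x))) ⟩
          window f χγ _ + (step f (ρ x) + step f (ρ x + P)) ∎ }
      where
      open ≡-Reasoning
      telescope : ∀ c b a → c - a ≡ (b - a) + (c - b)
      telescope = solve-∀

    minus-plus : ∀ t → (t - P) + P ≡ t
    minus-plus t = lemma t P
      where
      lemma : ∀ t q → (t - q) + q ≡ t
      lemma = solve-∀

    squareᵇ : ℕ → ℤ → Bool
    squareᵇ x = moveᵇ (moveᵇ χγ (ρ x) (ρ x + P)) (ρ x - P) (ρ x)

    squareᵇ-represents : ∀ x → Represents (squareᵇ x) (square x)
    squareᵇ-represents x = moveᵇ-represents _ _ (moveᵇ-represents _ _ (beadsᵇ-represents γ Pγ))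

    square-window : ∀ {x} → x ℕ.< p → ∀ f {B} → reach ℕ.≤ B →
                    window f (squareᵇ x) B ≡
                      (window f χγ B + f (ρ x + P)) - f (ρ x - P) * ⟦ χγ (ρ x - P) ⟧
    square-window {x} x<p f {B} reach≤B = begin
      window f (moveᵇ χ₁ (ρ x - P) (ρ x)) B
        ≡⟨ windowSum-moveᵇ f χ₁ lower≢ρx
             (near-ρ-in-window (- P) x<p (subst (ℕ._≤ 2 ℕ.* p) (sym (ℤₚ.∣-i∣≡∣i∣ P)) P≤2P) reach≤B)
             (ρ-in-window x<p reach≤B) ⟩
      (window f χ₁ B + f (ρ x - P) * (0ℤ - ⟦ χ₁ (ρ x - P) ⟧)) + f (ρ x) * (1ℤ - ⟦ χ₁ (ρ x) ⟧)
        ≡⟨ cong₂ (λ a b → (window f χ₁ B + f (ρ x - P) * (0ℤ - ⟦ a ⟧)) + f (ρ x) * (1ℤ - ⟦ b ⟧))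
                 lower-unchanged (moveᵇ-source χγ ρx≢ρx+P) ⟩
      (window f χ₁ B + f (ρ x - P) * (0ℤ - ⟦ χγ (ρ x - P) ⟧)) + f (ρ x) * (1ℤ - 0ℤ)
        ≡⟨ cong (λ w → (w + f (ρ x - P) * (0ℤ - ⟦ χγ (ρ x - P) ⟧)) + f (ρ x) * (1ℤ - 0ℤ))
             (windowSum-move-bead f χγ (bead-at-ρ x<p) (hole-at-ρ+P x<p)
                (ρ-in-window x<p reach≤B) (near-ρ-in-window P x<p P≤2P reach≤B)) ⟩
      ((window f χγ B + (f (ρ x + P) - f (ρ x))) + f (ρ x - P) * (0ℤ - ⟦ χγ (ρ x - P) ⟧))
        + f (ρ x) * (1ℤ - 0ℤ)
        ≡⟨ lemma (window f χγ B) (f (ρ x + P)) (f (ρ x)) (f (ρ x - P)) ⟦ χγ (ρ x - P) ⟧ ⟩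
      (window f χγ B + f (ρ x + P)) - f (ρ x - P) * ⟦ χγ (ρ x - P) ⟧ ∎
      where
      open ≡-Reasoning
      χ₁ = moveᵇ χγ (ρ x) (ρ x + P)
      ρx≢ρx+P = bead≢hole χγ (bead-at-ρ x<p) (hole-at-ρ+P x<p)
      lower≢ρx : ρ x - P ≢ ρ x
      lower≢ρx eq = ρx≢ρx+P (trans (sym (minus-plus (ρ x))) (cong (λ t → t + P) eq))
      lower≢ρx+P : ρ x - P ≢ ρ x + P
      lower≢ρx+P eq = bead≢hole χγ (bead-at-ρ x<p) (hole-below-ρ x<p 1)
                        (trans (sym (minus-plus (ρ x))) (trans (cong (λ t → t + P) eq) (sym (two-steps x))))
      lower-unchanged : χ₁ (ρ x - P) ≡ χγ (ρ x - P)
      lower-unchanged = moveᵇ-elsewhere χγ lower≢ρx lower≢ρx+P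
      lemma : ∀ w a b c d → ((w + (a - b)) + c * (0ℤ - d)) + b * (1ℤ - 0ℤ) ≡ (w + a) - c * d
      lemma = solve-∀

    square-pushes : ∀ {x} → x ℕ.< p → χγ (ρ x - P) ≡ true → Pushes (square x) (ρ x - P) (ρ x)
    square-pushes {x} x<p lower-bead = record
      { χ          = squareᵇ x
      ; represents = squareᵇ-represents x
      ; window-≡   = λ f {B} reach≤B →
          trans (square-window x<p f reach≤B)
                (trans (cong (λ b → (window f χγ B + f (ρ x + P)) - f (ρ x - P) * ⟦ b ⟧) lower-bead)
                       (trans (lemma (window f χγ B) (f (ρ x + P)) (f (ρ x)) (f (ρ x - P)))
                              (cong (λ t → window f χγ B + ((f t - f (ρ x - P)) + step f (ρ x)))
                                    (sym (minus-plus (ρ x)))))) }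
      where
      lemma : ∀ w a b c → (w + a) - c * 1ℤ ≡ w + ((b - c) + (a - b))
      lemma = solve-∀

    -- Otherwise square x adds a bead to γ, but every partition has exactly B beads
    -- in [-B, B] once B exceeds its first part and length.
    square-lower-bead : ∀ {x μ} → x ℕ.< p → IsPartition μ → HasAbacus μ (square x) → χγ (ρ x - P) ≡ true
    square-lower-bead {x} {μ} x<p Pμ abacus with χγ (ρ x - P) in no-lower-bead
    ... | true  = refl
    ... | false = ⊥-elim (ℤₚ.<-irrefl B≡1+B (ℤₚ.suc[i]≤j⇒i<j ℤₚ.≤-refl))
      where
      B = reach ℕ.+ (part μ 0 ℕ.+ length μ)
      reach≤B : reach ℕ.≤ B
      reach≤B = ℕₚ.m≤m+n reach _
      f = unitJump (- + B)
      χμ≡χ : ∀ t → beadsᵇ μ Pμ t ≡ squareᵇ x t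
      χμ≡χ = represents-unique (beadsᵇ-represents μ Pμ)
                               (represents-abacus {μ = μ} (squareᵇ-represents x) abacus)
      B≡1+B : + B ≡ 1ℤ + + B
      B≡1+B = begin
        + B                                                    ≡⟨ window-count μ Pμ μ-part μ-length ⟨
        window f (beadsᵇ μ Pμ) B                               ≡⟨ windowSum-cong f (+ B) (width B) χμ≡χ ⟩
        window f (squareᵇ x) B                                 ≡⟨ square-window x<p f reach≤B ⟩
        (window f χγ B + f (ρ x + P)) - f (ρ x - P) * ⟦ χγ (ρ x - P) ⟧
          ≡⟨ cong₂ (λ w b → (w + f (ρ x + P)) - f (ρ x - P) * ⟦ b ⟧)
                   (window-count γ Pγ (reach-part reach≤B) (reach-length reach≤B)) no-lower-bead ⟩
        (+ B + f (ρ x + P)) - f (ρ x - P) * 0ℤ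
          ≡⟨ cong (λ j → (+ B + j) - f (ρ x - P) * 0ℤ)
                  (unitJump-≥ { - + B} {ρ x + P} (∣i∣≤n⇒-n≤i (near-ρ P x<p P≤2P reach≤B))) ⟩
        (+ B + 1ℤ) - f (ρ x - P) * 0ℤ                          ≡⟨ lemma (+ B) (f (ρ x - P)) ⟩
        1ℤ + + B                                               ∎
        where
        open ≡-Reasoning
        lemma : ∀ b c → (b + 1ℤ) - c * 0ℤ ≡ 1ℤ + b
        lemma = solve-∀
        μ-part : part μ 0 ℕ.≤ B
        μ-part = ℕₚ.m≤n⇒m≤o+n reach (ℕₚ.m≤m+n (part μ 0) (length μ))
        μ-length : length μ ℕ.≤ B
        μ-length = ℕₚ.m≤n⇒m≤o+n reach (ℕₚ.m≤n+m (length μ) (part μ 0))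

    hingeSum-pushes : ∀ {S u v μ} → Pushes S u v → IsPartition μ → HasAbacus μ S →
                      ∀ c {B} → reach ℕ.≤ B → ∣ c ∣ ℕ.≤ B → part μ 0 ℕ.≤ B →
                      hingeSum c μ (width B) ≡ hingeSum c γ (width B) + (jump c p u + jump c p v)
    hingeSum-pushes {S} {u} {v} {μ} pushes Pμ abacus c {B} reach≤B c≤B part≤B = begin
      hingeSum c μ (width B)                  ≡⟨ window-beads (hinge c) μ Pμ part≤B vanish ⟨
      window (hinge c) (beadsᵇ μ Pμ) B        ≡⟨ windowSum-cong (hinge c) (+ B) (width B) χμ≡χ ⟩
      window (hinge c) χ B                    ≡⟨ window-≡ (hinge c) reach≤B ⟩
      window (hinge c) χγ B + (jump c p u + jump c p v)
        ≡⟨ cong (λ w → w + (jump c p u + jump c p v))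
                (window-beads (hinge c) γ Pγ (reach-part reach≤B) vanish) ⟩
      hingeSum c γ (width B) + (jump c p u + jump c p v) ∎
      where
      open ≡-Reasoning
      open Pushes pushes
      vanish : ∀ t → t ≤ -[1+ B ] → hinge c t ≡ 0ℤ
      vanish t t≤ =
        hinge-below (ℤₚ.≤-trans t≤ (ℤₚ.≤-trans (ℤₚ.<⇒≤ (-[1+n]<-n B)) (∣i∣≤n⇒-n≤i c≤B)))
      χμ≡χ : ∀ t → beadsᵇ μ Pμ t ≡ χ t
      χμ≡χ = represents-unique (beadsᵇ-represents μ Pμ) (represents-abacus {μ = μ} represents abacus)

    ⊴-from-pushes : ∀ {S S' u v u' v' μ ν} → Pushes S u v → Pushes S' u' v' → u ≤ u' → v ≤ v' →
                    IsPartition μ → IsPartition ν → HasAbacus μ S → HasAbacus ν S' → μ ⊴ ν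
    ⊴-from-pushes {u = u} {v} {u'} {v'} {μ} {ν} pushesμ pushesν u≤u' v≤v' Pμ Pν abacusμ abacusν =
      ⊴-from-hingeSums Pν compare
      where
      compare : ∀ c k → ∃[ n ] k ℕ.≤ n × hingeSum c μ n ≤ hingeSum c ν n
      compare c k = width B , k≤width , (begin
        hingeSum c μ (width B)
          ≡⟨ hingeSum-pushes pushesμ Pμ abacusμ c reach≤B c≤B μ≤B ⟩
        hingeSum c γ (width B) + (jump c p u + jump c p v)
          ≤⟨ ℤₚ.+-monoʳ-≤ (hingeSum c γ (width B))
                          (ℤₚ.+-mono-≤ (jump-mono c p u≤u') (jump-mono c p v≤v')) ⟩
        hingeSum c γ (width B) + (jump c p u' + jump c p v')
          ≡⟨ hingeSum-pushes pushesν Pν abacusν c reach≤B c≤B ν≤B ⟨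
        hingeSum c ν (width B)                              ∎)
        where
        open ℤₚ.≤-Reasoning
        B = reach ℕ.+ (∣ c ∣ ℕ.+ k ℕ.+ (part μ 0 ℕ.+ part ν 0))
        reach≤B : reach ℕ.≤ B
        reach≤B = ℕₚ.m≤m+n reach _
        c≤B : ∣ c ∣ ℕ.≤ B
        c≤B = ℕₚ.m≤n⇒m≤o+n reach (ℕₚ.m≤n⇒m≤n+o _ (ℕₚ.m≤m+n ∣ c ∣ k))
        μ≤B : part μ 0 ℕ.≤ B
        μ≤B = ℕₚ.m≤n⇒m≤o+n reach
                (ℕₚ.m≤n⇒m≤o+n (∣ c ∣ ℕ.+ k) (ℕₚ.m≤m+n (part μ 0) (part ν 0)))
        ν≤B : part ν 0 ℕ.≤ B
        ν≤B = ℕₚ.m≤n⇒m≤o+n reach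
                (ℕₚ.m≤n⇒m≤o+n (∣ c ∣ ℕ.+ k) (ℕₚ.m≤n+m (part ν 0) (part μ 0)))
        k≤width : k ℕ.≤ width B
        k≤width = ℕₚ.m≤n⇒m≤1+n (ℕₚ.m≤n⇒m≤n+o B
                    (ℕₚ.m≤n⇒m≤o+n reach (ℕₚ.m≤n⇒m≤n+o _ (ℕₚ.m≤n+m k ∣ c ∣))))

    -- Past the last runner ρ̂ exceeds every ρ a + P, so that the pyramid value 0
    -- for b ≥ p also reads ρ̂ a + P ≤ ρ̂ b.
    ρ̂ : ℕ → ℤ
    ρ̂ r with r ℕ.<? p
    ... | yes _ = ρ r
    ... | no  _ = ρ (p ℕ.∸ 1) + P

    ρ̂-< : ∀ {r} → r ℕ.< p → ρ̂ r ≡ ρ r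
    ρ̂-< {r} r<p with r ℕ.<? p
    ... | yes _   = refl
    ... | no  r≮p = ⊥-elim (r≮p r<p)

    ρ̂-≥ : ∀ {r} → ¬ r ℕ.< p → ρ̂ r ≡ ρ (p ℕ.∸ 1) + P
    ρ̂-≥ {r} r≮p with r ℕ.<? p
    ... | yes r<p = ⊥-elim (r≮p r<p)
    ... | no  _   = refl

    ρ̂-mono : ∀ {r s} → r ℕ.≤ s → ρ̂ r ≤ ρ̂ s
    ρ̂-mono {r} {s} r≤s with r ℕ.<? p | s ℕ.<? p
    ... | yes _   | yes s<p = ρ-mono r≤s s<p
    ... | yes r<p | no  _   = ℤₚ.≤-trans (ρ-mono (below-last r<p) (last<p r<p)) (ℤₚ.i≤i+j _ P)
    ... | no  r≮p | yes s<p = ⊥-elim (r≮p (ℕₚ.≤-<-trans r≤s s<p))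
    ... | no  _   | no  _   = ℤₚ.≤-refl

    ρ̂-beyond : ∀ {a b} → a ℕ.< p → ¬ b ℕ.< p → ρ̂ a + P ≤ ρ̂ b
    ρ̂-beyond a<p b≮p = subst₂ (λ x y → x + P ≤ y) (sym (ρ̂-< a<p)) (sym (ρ̂-≥ b≮p))
                                (ℤₚ.+-monoˡ-≤ P (ρ-mono (below-last a<p) (last<p a<p)))

    pyr-true : ∀ {a b} → a ℕ.≤ b → pyr a b ≡ true → b ℕ.< p × ρ̂ b < ρ̂ a + P
    pyr-true {a} {b} a≤b with b <ᵇ a in b<ᵇa
    ... | true  = ⊥-elim (ℕₚ.<⇒≱ (ℕₚ.<ᵇ⇒< b a (T-from-≡ b<ᵇa)) a≤b)
    ... | false with p ≤ᵇ b in p≤ᵇb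
    ...   | true  = λ ()
    ...   | false with (ρ b - ρ a) ℤ.<? P
    ...     | no  _       = λ ()
    ...     | yes ρb-ρa<P = λ _ →
      b<p , subst₂ (λ x y → x < y + P) (sym (ρ̂-< b<p)) (sym (ρ̂-< a<p))
                   (ℤₚ.suc[i]≤j⇒i<j (≤-by-gap (ℤₚ.i<j⇒suc[i]≤j ρb-ρa<P) (lemma (ρ a) (ρ b) P)))
      where
      b<p = ≤ᵇ-false⇒> p≤ᵇb
      a<p = ℕₚ.≤-<-trans a≤b b<p
      lemma : ∀ a b q → (a + q) - (1ℤ + b) ≡ q - (1ℤ + (b - a))
      lemma = solve-∀

    pyr-false : ∀ {a b} → a ℕ.≤ b → a ℕ.< p → pyr a b ≡ false → ρ̂ a + P ≤ ρ̂ b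
    pyr-false {a} {b} a≤b a<p with b <ᵇ a in b<ᵇa
    ... | true  = ⊥-elim (ℕₚ.<⇒≱ (ℕₚ.<ᵇ⇒< b a (T-from-≡ b<ᵇa)) a≤b)
    ... | false with p ≤ᵇ b in p≤ᵇb
    ...   | true  = λ _ → ρ̂-beyond a<p (ℕₚ.≤⇒≯ (ℕₚ.≤ᵇ⇒≤ p b (T-from-≡ p≤ᵇb)))
    ...   | false with (ρ b - ρ a) ℤ.<? P
    ...     | yes _       = λ ()
    ...     | no  ρb-ρa≮P = λ _ →
      subst₂ (λ x y → x + P ≤ y) (sym (ρ̂-< a<p)) (sym (ρ̂-< (≤ᵇ-false⇒> p≤ᵇb)))
             (≤-by-gap (ℤₚ.≮⇒≥ ρb-ρa≮P) (lemma (ρ a) (ρ b) P))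
      where
      lemma : ∀ a b q → b - (a + q) ≡ (b - a) - q
      lemma = solve-∀

    -- The three regimes of each clamp are the cases of ⌈a,b⌋ decided by the pyramid.
    firstPush : ℕ → ℕ → ℤ
    firstPush a b = clamp (ρ̂ a) (ρ̂ (suc a)) (ρ̂ b - P)

    secondPush : ℕ → ℕ → ℤ
    secondPush a b = clamp (ρ̂ b) (ρ̂ (suc b)) (ρ̂ a + P)

    firstPush-mono : ∀ {a a' b b'} → a ℕ.≤ a' → b ℕ.≤ b' → firstPush a b ≤ firstPush a' b'
    firstPush-mono a≤a' b≤b' =
      clamp-mono (ρ̂-mono a≤a') (ρ̂-mono (s≤s a≤a')) (ℤₚ.+-monoˡ-≤ (- P) (ρ̂-mono b≤b'))

    secondPush-mono : ∀ {a a' b b'} → a ℕ.≤ a' → b ℕ.≤ b' → secondPush a b ≤ secondPush a' b'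
    secondPush-mono a≤a' b≤b' =
      clamp-mono (ρ̂-mono b≤b') (ρ̂-mono (s≤s b≤b')) (ℤₚ.+-monoˡ-≤ P (ρ̂-mono a≤a'))

    relabel : ∀ {S S' u u' v v'} → S ≡ S' → u ≡ u' → v ≡ v' → Pushes S' u v → Pushes S u' v'
    relabel refl refl refl pushes = pushes

    x<x+P : ∀ {r} → r ℕ.< p → ∀ x → x < x + P
    x<x+P r<p x = subst (_< x + P) (ℤₚ.+-identityʳ x) (ℤₚ.+-monoʳ-< x (ℤ.+<+ (ℕₚ.≤-<-trans z≤n r<p)))

    ⌈⌋-pushes-< : ∀ {a b μ} → a ℕ.< b → b ℕ.< p → IsPartition μ → HasAbacus μ ⌈ a , b ⌋ →
                  Pushes ⌈ a , b ⌋ (firstPush a b) (secondPush a b)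
    ⌈⌋-pushes-< {a} {b} {μ} a<b b<p Pμ abacus = cases (pyr (suc a) b) (pyr a b) (pyr a (suc b)) refl refl refl
      where
      a<p = ℕₚ.<-trans a<b b<p
      1+a<p = ℕₚ.≤-<-trans a<b b<p
      a≤1+b = ℕₚ.≤-trans (ℕₚ.<⇒≤ a<b) (ℕₚ.n≤1+n b)
      A₀≤A₁ = ρ̂-mono (ℕₚ.n≤1+n a)
      B≤B₁ = ρ̂-mono (ℕₚ.n≤1+n b)

      cases : ∀ b₁ b₂ b₃ → pyr (suc a) b ≡ b₁ → pyr a b ≡ b₂ → pyr a (suc b) ≡ b₃ →
              Pushes ⌈ a , b ⌋ (firstPush a b) (secondPush a b)
      cases false _ _ e₁ _ _ =
        relabel label (trans (sym (ρ̂-< 1+a<p)) (sym (clamp-above A₀≤A₁ (i+k≤j⇒i≤j-k P A₁+P≤B))))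
                      (trans (sym (ρ̂-< b<p))
                             (sym (clamp-below (ℤₚ.≤-trans (ℤₚ.+-monoˡ-≤ P A₀≤A₁) A₁+P≤B))))
                      (pair-pushes 1+a<b b<p)
        where
        A₁+P≤B = pyr-false a<b 1+a<p e₁
        1+a<b : suc a ℕ.< b
        1+a<b with ℕₚ.m≤n⇒m<n∨m≡n a<b
        ... | inj₁ 1+a<b = 1+a<b
        ... | inj₂ refl  = ⊥-elim (ℤₚ.<⇒≱ (x<x+P b<p (ρ̂ b)) A₁+P≤B)
        label : ⌈ a , b ⌋ ≡ pairL (suc a) b
        label rewrite ≡ᵇ-false (ℕₚ.<⇒≢ a<b) | ℕₚ.+-comm a 1 | e₁ = refl
      cases true false _ e₁ e₂ _ =
        relabel label (sym (clamp-inside (i+k≤j⇒i≤j-k P A₀+P≤B) (j≤i+k⇒j-k≤i P (ℤₚ.<⇒≤ B<A₁+P))))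
                      (trans (sym (ρ̂-< b<p)) (sym (clamp-below A₀+P≤B)))
                      (subst₂ (Pushes (square b)) (cong (_- P) (sym (ρ̂-< b<p))) refl
                        (square-pushes b<p (square-lower-bead b<p Pμ (subst (HasAbacus μ) label abacus))))
        where
        B<A₁+P = proj₂ (pyr-true a<b e₁)
        A₀+P≤B = pyr-false (ℕₚ.<⇒≤ a<b) a<p e₂
        label : ⌈ a , b ⌋ ≡ square b
        label rewrite ≡ᵇ-false (ℕₚ.<⇒≢ a<b) | ℕₚ.+-comm a 1 | e₁ | e₂ = refl
      cases true true false e₁ e₂ e₃ =
        relabel label (trans (sym (ρ̂-< a<p)) (sym (clamp-below (j≤i+k⇒j-k≤i P (ℤₚ.<⇒≤ B<A₀+P)))))
                      (trans (cong (_+ P) (sym (ρ̂-< a<p)))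
                             (sym (clamp-inside (ℤₚ.<⇒≤ B<A₀+P) (pyr-false a≤1+b a<p e₃))))
                      (single-pushes a<p)
        where
        B<A₀+P = proj₂ (pyr-true (ℕₚ.<⇒≤ a<b) e₂)
        label : ⌈ a , b ⌋ ≡ single a
        label rewrite ≡ᵇ-false (ℕₚ.<⇒≢ a<b) | ℕₚ.+-comm a 1 | ℕₚ.+-comm b 1 | e₁ | e₂ | e₃ = refl
      cases true true true e₁ e₂ e₃ =
        relabel label (trans (sym (ρ̂-< a<p))
                             (sym (clamp-below (j≤i+k⇒j-k≤i P
                                                  (ℤₚ.<⇒≤ (ℤₚ.≤-<-trans B≤B₁ B₁<A₀+P))))))
                      (trans (sym (ρ̂-< 1+b<p)) (sym (clamp-above B≤B₁ (ℤₚ.<⇒≤ B₁<A₀+P))))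
                      (pair-pushes (ℕₚ.<-trans a<b (ℕₚ.n<1+n b)) 1+b<p)
        where
        1+b<p = proj₁ (pyr-true a≤1+b e₃)
        B₁<A₀+P = proj₂ (pyr-true a≤1+b e₃)
        label : ⌈ a , b ⌋ ≡ pairL a (suc b)
        label rewrite ≡ᵇ-false (ℕₚ.<⇒≢ a<b) | ℕₚ.+-comm a 1 | ℕₚ.+-comm b 1 | e₁ | e₂ | e₃ = refl

    ⌈⌋-pushes-≡ : ∀ {a} → suc a ℕ.< p →
                  Pushes ⌈ a , a ⌋ (firstPush (suc a) (suc a)) (secondPush (suc a) (suc a))
    ⌈⌋-pushes-≡ {a} 1+a<p = cases (pyr (suc a) (suc (suc a))) refl
      where
      A₁≡first : ρ (suc a) ≡ firstPush (suc a) (suc a)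
      A₁≡first = trans (sym (ρ̂-< 1+a<p)) (sym (clamp-below (ℤₚ.i-j≤i (ρ̂ (suc a)) P)))

      cases : ∀ b → pyr (suc a) (suc (suc a)) ≡ b →
              Pushes ⌈ a , a ⌋ (firstPush (suc a) (suc a)) (secondPush (suc a) (suc a))
      cases true e =
        relabel label A₁≡first
                (trans (sym (ρ̂-< 2+a<p))
                       (sym (clamp-above (ρ̂-mono (ℕₚ.n≤1+n (suc a))) (ℤₚ.<⇒≤ A₂<A₁+P))))
                (pair-pushes (ℕₚ.n<1+n (suc a)) 2+a<p)
        where
        2+a<p = proj₁ (pyr-true (ℕₚ.n≤1+n (suc a)) e)
        A₂<A₁+P = proj₂ (pyr-true (ℕₚ.n≤1+n (suc a)) e)
        label : ⌈ a , a ⌋ ≡ pairL (suc a) (suc (suc a))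
        label rewrite ≡ᵇ-refl a | ℕₚ.+-comm a 1 | ℕₚ.+-comm a 2 | e = refl
      cases false e =
        relabel label A₁≡first
                (trans (cong (_+ P) (sym (ρ̂-< 1+a<p)))
                       (sym (clamp-inside (ℤₚ.<⇒≤ (x<x+P 1+a<p (ρ̂ (suc a))))
                                          (pyr-false (ℕₚ.n≤1+n (suc a)) 1+a<p e))))
                (single-pushes 1+a<p)
        where
        label : ⌈ a , a ⌋ ≡ single (suc a)
        label rewrite ≡ᵇ-refl a | ℕₚ.+-comm a 1 | ℕₚ.+-comm a 2 | e = refl

    ⌈⌋-⊴ : ∀ {a b a' b' μ ν} → a ℕ.< b → a' ℕ.< b' → a ℕ.≤ a' → b ℕ.≤ b' → b' ℕ.< p →
           IsPartition μ → IsPartition ν → HasAbacus μ ⌈ a , b ⌋ → HasAbacus ν ⌈ a' , b' ⌋ → μ ⊴ ν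
    ⌈⌋-⊴ a<b a'<b' a≤a' b≤b' b'<p Pμ Pν μ-abacus ν-abacus =
      ⊴-from-pushes (⌈⌋-pushes-< a<b (ℕₚ.≤-<-trans b≤b' b'<p) Pμ μ-abacus)
                    (⌈⌋-pushes-< a'<b' b'<p Pν ν-abacus)
                    (firstPush-mono a≤a' b≤b') (secondPush-mono a≤a' b≤b') Pμ Pν μ-abacus ν-abacus

    ⌈⌋-⊴-diagonal : ∀ {a μ ν} → suc (suc a) ℕ.< p → IsPartition μ → IsPartition ν →
                    HasAbacus μ ⌈ a , suc a ⌋ → HasAbacus ν ⌈ suc a , suc a ⌋ → μ ⊴ ν
    ⌈⌋-⊴-diagonal {a} 2+a<p Pμ Pν μ-abacus ν-abacus =
      ⊴-from-pushes (⌈⌋-pushes-< (ℕₚ.n<1+n a) 1+a<p Pμ μ-abacus) (⌈⌋-pushes-≡ 2+a<p)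
                    (firstPush-mono a≤2+a (ℕₚ.n≤1+n _)) (secondPush-mono a≤2+a (ℕₚ.n≤1+n _))
                    Pμ Pν μ-abacus ν-abacus
      where
      1+a<p = ℕₚ.<-trans (ℕₚ.n<1+n (suc a)) 2+a<p
      a≤2+a = ℕₚ.≤-trans (ℕₚ.n≤1+n a) (ℕₚ.n≤1+n _)


open Dominance using (module CoreAbacus)
open import Data.Nat using (ℕ; zero; suc; _+_; _*_; _∸_; _≤_; _<_; _%_)
import Data.Nat.Properties as ℕₚ
open import Data.Nat.Primality using (Prime)
open import Data.Integer using (ℤ)
open import Data.List using (List)
open import Data.Product using (_×_; _,_)
open import Data.Sum using (inj₁; inj₂)
open import Relation.Binary.PropositionalEquality using (_≡_; refl; subst)

proposition3p14 :
    (p n : ℕ) → Prime p → p % 2 ≡ 1 →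
    (γ : List ℕ) → IsPartition γ → size γ + 2 * p ≡ n →
    SelfConjugate γ → IsCore p γ →
    (ρ : ℕ → ℤ) → IsRho p γ ρ →
    (i j : ℕ) → 1 ≤ i → i ≤ j → j < p → i < p ∸ 1 →
    ((μ ν : List ℕ) → IsPartition μ → IsPartition ν →
      HasAbacus μ (Labels.⌈_,_⌋ p γ ρ (i ∸ 1) j) →
      HasAbacus ν (Labels.⌈_,_⌋ p γ ρ i j) → μ ⊴ ν)
    ×
    (j + 1 ≤ p ∸ 1 →
     (μ ν : List ℕ) → IsPartition μ → IsPartition ν →
      HasAbacus μ (Labels.⌈_,_⌋ p γ ρ (i ∸ 1) j) →
      HasAbacus ν (Labels.⌈_,_⌋ p γ ρ (i ∸ 1) (j + 1)) → μ ⊴ ν)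
proposition3p14 _ _ _ _ _ _ _ _ _ _ _ zero _ () _ _ _
proposition3p14 p _ _ _ γ Pγ _ _ _ ρ R (suc a) j _ 1+a≤j j<p 2+a≤p∸1 = raise-first , raise-second
  where
  open CoreAbacus p γ Pγ ρ R
  open Labels p γ ρ using (⌈_,_⌋)
  a<j = ℕₚ.<-≤-trans (ℕₚ.n<1+n a) 1+a≤j
  raise-first : ∀ μ ν → IsPartition μ → IsPartition ν →
                HasAbacus μ ⌈ a , j ⌋ → HasAbacus ν ⌈ suc a , j ⌋ → μ ⊴ ν
  raise-first μ ν Pμ Pν with ℕₚ.m≤n⇒m<n∨m≡n 1+a≤j
  ... | inj₁ 1+a<j = ⌈⌋-⊴ a<j 1+a<j (ℕₚ.n≤1+n a) ℕₚ.≤-refl j<p Pμ Pν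
  ... | inj₂ refl  = ⌈⌋-⊴-diagonal (ℕₚ.≤-<-trans 2+a≤p∸1 (last<p j<p)) Pμ Pν
  raise-second : j + 1 ≤ p ∸ 1 → ∀ μ ν → IsPartition μ → IsPartition ν →
                 HasAbacus μ ⌈ a , j ⌋ → HasAbacus ν ⌈ a , j + 1 ⌋ → μ ⊴ ν
  raise-second j+1≤p∸1 μ ν Pμ Pν μ-abacus ν-abacus =
    ⌈⌋-⊴ a<j (ℕₚ.<-trans a<j (ℕₚ.n<1+n j)) ℕₚ.≤-refl (ℕₚ.n≤1+n j) 1+j<p Pμ Pν
         μ-abacus (subst (λ k → HasAbacus ν ⌈ a , k ⌋) (ℕₚ.+-comm j 1) ν-abacus)
    where
    1+j<p = ℕₚ.≤-<-trans (subst (_≤ p ∸ 1) (ℕₚ.+-comm j 1) j+1≤p∸1) (last<p j<p)
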